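{- Let $G$ be a finite group with identity $e$, let $L$ be its Cayley table, $L(x,y)=xy$, and let $K$ be the Latin square $K(x,y)=x\mu(y)$, where $\mu\colon G\to G$ is a bijection with $\mu(e)=e$, such that $L$ and $K$ are orthogonal. Let $(\alpha,\beta,\gamma,\delta)$ be an autotopy of $(L,K)$, i.e. bijections $G\to G$ with $\gamma(xy)=\alpha(x)\beta(y)$ and $\delta(x\mu(y))=\alpha(x)\mu(\beta(y))$ for all $x,y\in G$. Then there exist $a,b\in G$ and $\varphi\in\mathrm{Aut}(G)$ with $\varphi(\mu(y))\mu(b^{ -1})=\mu(\varphi(y)b^{ -1})$ for all $y\in G$, such that for all $z\in G$: $\alpha(z)=a\varphi(z)$, $\beta(z)=\varphi(z)b^{ -1}$, $\gamma(z)=a\varphi(z)b^{ -1}$, and $\delta(z)=a\varphi(z)\mu(b^{ -1})$.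
   Context: Latin squares $L,K$ on $G$ (rows, columns indexed by $G$) are orthogonal if every ordered pair of symbols occurs exactly once among the pairs $(L(x,y),K(x,y))$. An autotopy of the pair $(L,K)$ is a quadruple of bijections of $G$ (acting on rows, columns, symbols of $L$, symbols of $K$) preserving the orthogonal array $\{(x,y,xy,x\mu(y))\}$, which amounts to the two displayed identities. -}

module Defs where

open import Level using (0ℓ)
open import Data.Nat using (ℕ)
open import Data.Fin using (Fin)
open import Data.Product using (_×_; _,_)
open import Relation.Binary.PropositionalEquality using (_≡_)
open import Algebra.Structures using (IsGroup)
open import Function.Bundles using (_↔_; Inverse)
open import Function.Definitions using (Bijective)

record FiniteGroup : Set₁ where
  infixl 7 _∙_
  field
    Carrier : Set
    _∙_     : Carrier → Carrier → Carrier
    e       : Carrier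
    _⁻¹     : Carrier → Carrier
    isGroup : IsGroup _≡_ _∙_ e _⁻¹
    size    : ℕ
    enum    : Carrier ↔ Fin size

module _ (G : FiniteGroup) where
  open FiniteGroup G

  L : Carrier → Carrier → Carrier
  L x y = x ∙ y

  K : (Carrier → Carrier) → Carrier → Carrier → Carrier
  K μ x y = x ∙ μ y

  -- Two squares on G are orthogonal: each ordered pair of symbols occurs
  -- exactly once among (A(x,y), B(x,y)), i.e. (x,y) ↦ (A(x,y),B(x,y)) is
  -- a bijection G×G → G×G.
  Orthogonal : (Carrier → Carrier → Carrier) → (Carrier → Carrier → Carrier) → Set
  Orthogonal A B =
    Bijective {A = Carrier × Carrier} _≡_ _≡_ (λ p → A (Data.Product.proj₁ p) (Data.Product.proj₂ p)
                                                  , B (Data.Product.proj₁ p) (Data.Product.proj₂ p))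

  IsAutomorphism : Carrier ↔ Carrier → Set
  IsAutomorphism φ = ∀ x y → Inverse.to φ (x ∙ y) ≡ Inverse.to φ x ∙ Inverse.to φ y

{-# OPTIONS --safe #-}
-- An autotopy (α, β, γ) of the Cayley table of a group is determined by α together with
-- the single value β(e): putting y = e and x = e in γ(xy) = α(x)β(y) expresses γ through α
-- and β through γ, and φ(z) = α(e)⁻¹α(z) is then forced to be an automorphism.  Putting
-- x = e and y = e in the identity for δ gives δ and the compatibility of φ with μ.
module Submission where

open import Defs
open import Level using (Level)
open import Data.Product using (Σ; _×_; _,_)
open import Relation.Binary.PropositionalEquality using (_≡_; sym; cong; cong₂; module ≡-Reasoning)
open import Function.Bundles using (_↔_; Inverse; mk↔ₛ′)
open import Function.Construct.Composition using (_↔-∘_)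
open import Algebra.Core using (Op₁; Op₂)
open import Algebra.Structures using (IsGroup)
open import Algebra.Bundles using (Group)
import Algebra.Properties.Group as GroupProperties

module GroupAutotopy {c : Level} {A : Set c} {mul : Op₂ A} {unit : A} {inv : Op₁ A}
                     (isGroup : IsGroup _≡_ mul unit inv) where

  group : Group c c
  group = record { isGroup = isGroup }

  -- The operations are reopened from the bundle because only its names carry fixities.
  open Group group using (_∙_; ε; _⁻¹; assoc; identityˡ; identityʳ)
  open GroupProperties group
    using (\\-leftDividesˡ; \\-leftDividesʳ; ∙-cancelˡ; ∙-cancelʳ; ⁻¹-involutive)
  open Inverse using (to)
  open ≡-Reasoning

  translateˡ : A → A ↔ A
  translateˡ g = mk↔ₛ′ (g ∙_) (g ⁻¹ ∙_) (\\-leftDividesˡ g) (\\-leftDividesʳ g)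

  module CayleyTable (α : A ↔ A) (β γ : A → A)
                     (γ-split : ∀ x y → γ (x ∙ y) ≡ to α x ∙ β y) where

    a b : A
    a = to α ε
    b = β ε ⁻¹

    φ : A ↔ A
    φ = translateˡ (a ⁻¹) ↔-∘ α

    b⁻¹≡β-ε : b ⁻¹ ≡ β ε
    b⁻¹≡β-ε = ⁻¹-involutive (β ε)

    γ≡α∙β-ε : ∀ z → γ z ≡ to α z ∙ β ε
    γ≡α∙β-ε z = begin
      γ z           ≡⟨ cong γ (identityʳ z) ⟨
      γ (z ∙ ε)     ≡⟨ γ-split z ε ⟩
      to α z ∙ β ε  ∎

    γ≡a∙β : ∀ z → γ z ≡ a ∙ β z
    γ≡a∙β z = begin
      γ z        ≡⟨ cong γ (identityˡ z) ⟨
      γ (ε ∙ z)  ≡⟨ γ-split ε z ⟩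
      a ∙ β z    ∎

    α≡a∙φ : ∀ z → to α z ≡ a ∙ to φ z
    α≡a∙φ z = sym (\\-leftDividesˡ a (to α z))

    β≡φ∙b⁻¹ : ∀ z → β z ≡ to φ z ∙ b ⁻¹
    β≡φ∙b⁻¹ z = begin
      β z                     ≡⟨ \\-leftDividesʳ a (β z) ⟨
      a ⁻¹ ∙ (a ∙ β z)        ≡⟨ cong (a ⁻¹ ∙_) (γ≡a∙β z) ⟨
      a ⁻¹ ∙ γ z              ≡⟨ cong (a ⁻¹ ∙_) (γ≡α∙β-ε z) ⟩
      a ⁻¹ ∙ (to α z ∙ β ε)   ≡⟨ assoc (a ⁻¹) (to α z) (β ε) ⟨
      to φ z ∙ β ε            ≡⟨ cong (to φ z ∙_) b⁻¹≡β-ε ⟨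
      to φ z ∙ b ⁻¹           ∎

    γ≡a∙φ∙b⁻¹ : ∀ z → γ z ≡ a ∙ to φ z ∙ b ⁻¹
    γ≡a∙φ∙b⁻¹ z = begin
      γ z                  ≡⟨ γ≡a∙β z ⟩
      a ∙ β z              ≡⟨ cong (a ∙_) (β≡φ∙b⁻¹ z) ⟩
      a ∙ (to φ z ∙ b ⁻¹)  ≡⟨ assoc a (to φ z) (b ⁻¹) ⟨
      a ∙ to φ z ∙ b ⁻¹    ∎

    φ-homo-∙ : ∀ x y → to φ (x ∙ y) ≡ to φ x ∙ to φ y
    φ-homo-∙ x y = ∙-cancelˡ a _ _ (∙-cancelʳ (b ⁻¹) _ _ (begin
      a ∙ to φ (x ∙ y) ∙ b ⁻¹              ≡⟨ γ≡a∙φ∙b⁻¹ (x ∙ y) ⟨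
      γ (x ∙ y)                            ≡⟨ γ-split x y ⟩
      to α x ∙ β y                         ≡⟨ cong₂ _∙_ (α≡a∙φ x) (β≡φ∙b⁻¹ y) ⟩
      a ∙ to φ x ∙ (to φ y ∙ b ⁻¹)         ≡⟨ assoc (a ∙ to φ x) (to φ y) (b ⁻¹) ⟨
      a ∙ to φ x ∙ to φ y ∙ b ⁻¹           ≡⟨ cong (_∙ b ⁻¹) (assoc a (to φ x) (to φ y)) ⟩
      a ∙ (to φ x ∙ to φ y) ∙ b ⁻¹         ∎))

    module TwistedCayleyTable (μ δ : A → A) (δ-split : ∀ x y → δ (x ∙ μ y) ≡ to α x ∙ μ (β y)) where

      δ≡a∙φ∙μb⁻¹ : μ ε ≡ ε → ∀ z → δ z ≡ a ∙ to φ z ∙ μ (b ⁻¹)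
      δ≡a∙φ∙μb⁻¹ μ-ε z = begin
        δ z                     ≡⟨ cong δ (identityʳ z) ⟨
        δ (z ∙ ε)               ≡⟨ cong (λ t → δ (z ∙ t)) μ-ε ⟨
        δ (z ∙ μ ε)             ≡⟨ δ-split z ε ⟩
        to α z ∙ μ (β ε)        ≡⟨ cong₂ (λ s t → s ∙ μ t) (α≡a∙φ z) (sym b⁻¹≡β-ε) ⟩
        a ∙ to φ z ∙ μ (b ⁻¹)   ∎

      φ-μ-compatible : μ ε ≡ ε → ∀ y → to φ (μ y) ∙ μ (b ⁻¹) ≡ μ (to φ y ∙ b ⁻¹)
      φ-μ-compatible μ-ε y = ∙-cancelˡ a _ _ (begin
        a ∙ (to φ (μ y) ∙ μ (b ⁻¹))   ≡⟨ assoc a (to φ (μ y)) (μ (b ⁻¹)) ⟨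
        a ∙ to φ (μ y) ∙ μ (b ⁻¹)     ≡⟨ δ≡a∙φ∙μb⁻¹ μ-ε (μ y) ⟨
        δ (μ y)                       ≡⟨ cong δ (identityˡ (μ y)) ⟨
        δ (ε ∙ μ y)                   ≡⟨ δ-split ε y ⟩
        a ∙ μ (β y)                   ≡⟨ cong (λ t → a ∙ μ t) (β≡φ∙b⁻¹ y) ⟩
        a ∙ μ (to φ y ∙ b ⁻¹)         ∎)

theorem5p4 : (G : FiniteGroup) → let open FiniteGroup G in
    (μ : Carrier ↔ Carrier) → Inverse.to μ e ≡ e →
    Orthogonal G (L G) (K G (Inverse.to μ)) →
    (α β γ δ : Carrier ↔ Carrier) →
    (∀ x y → Inverse.to γ (x ∙ y) ≡ Inverse.to α x ∙ Inverse.to β y) →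
    (∀ x y → Inverse.to δ (x ∙ Inverse.to μ y) ≡ Inverse.to α x ∙ Inverse.to μ (Inverse.to β y)) →
    Σ Carrier λ a → Σ Carrier λ b → Σ (Carrier ↔ Carrier) λ φ →
      IsAutomorphism G φ
      × (∀ y → Inverse.to φ (Inverse.to μ y) ∙ Inverse.to μ (b ⁻¹) ≡ Inverse.to μ (Inverse.to φ y ∙ b ⁻¹))
      × (∀ z → Inverse.to α z ≡ a ∙ Inverse.to φ z)
      × (∀ z → Inverse.to β z ≡ Inverse.to φ z ∙ b ⁻¹)
      × (∀ z → Inverse.to γ z ≡ a ∙ Inverse.to φ z ∙ b ⁻¹)
      × (∀ z → Inverse.to δ z ≡ a ∙ Inverse.to φ z ∙ Inverse.to μ (b ⁻¹))
theorem5p4 G μ μ-e _ α β γ δ γ-split δ-split =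
  a , b , φ , φ-homo-∙ , φ-μ-compatible μ-e , α≡a∙φ , β≡φ∙b⁻¹ , γ≡a∙φ∙b⁻¹ , δ≡a∙φ∙μb⁻¹ μ-e
  where
  open GroupAutotopy (FiniteGroup.isGroup G)
  open CayleyTable α (Inverse.to β) (Inverse.to γ) γ-split
  open TwistedCayleyTable (Inverse.to μ) (Inverse.to δ) δ-split
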